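{- There is an absolute constant $c>0$ such that for every integer $d\ge2$ with $d-1$ a perfect square, the following holds. Let \[\mathcal P=\{(x_1,\dots,x_d): x_1,\dots,x_{d-1}\in\{ -1,1\},\ x_d\in\mathbb Z,\ -2\sqrt{d-1}\le x_d\le 2\sqrt{d-1}\}\] and let $\mathcal H$ be the set of hyperplanes $\{x\in\mathbb R^d:\sum_{i=1}^d a_ix_i=0\}$ with $a_1,\dots,a_{d-1}\in\{0,1\}$ and $a_d=-1$. Then $\operatorname{I}(\mathcal P,\mathcal H)\ge c\,2^{2d}$.
   Context: $\operatorname{I}(\mathcal P,\mathcal H)$ denotes the number of pairs $(p,h)\in\mathcal P\times\mathcal H$ with $p\in h$. -}

module Defs where

open import Data.Nat using (ℕ; zero; suc; _*_)
open import Data.Integer as ℤ using (ℤ; +_; -[1+_]; _-_) renaming (_+_ to _+ℤ_; _*_ to _*ℤ_)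
open import Data.List using (List; []; _∷_; map; concatMap; length; filter; cartesianProduct; upTo)
open import Data.Vec using (Vec; []; _∷_; _∷ʳ_)
open import Data.Product using (_×_; _,_)
open import Relation.Binary.PropositionalEquality using (_≡_)

allVecs : List ℤ → (n : ℕ) → List (Vec ℤ n)
allVecs vals zero    = [] ∷ []
allVecs vals (suc n) = concatMap (λ x → map (x ∷_) (allVecs vals n)) vals

intRange : ℕ → List ℤ
intRange b = map (λ k → + k - + b) (upTo (suc (b * 2)))

dot : ∀ {d} → Vec ℤ d → Vec ℤ d → ℤ
dot []       []       = + 0
dot (a ∷ as) (x ∷ xs) = a *ℤ x +ℤ dot as xs

-- The point set P in dimension d = n + 1 with sqrt(d-1) = m:
-- x_1..x_n ∈ {-1,1}, x_d ∈ ℤ with -2m ≤ x_d ≤ 2m.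
pointSet : (n m : ℕ) → List (Vec ℤ (suc n))
pointSet n m = concatMap (λ v → map (v ∷ʳ_) (intRange (2 * m))) (allVecs (-[1+ 0 ] ∷ + 1 ∷ []) n)

-- The hyperplanes H, represented by their coefficient vectors (a_1,…,a_n,-1)
-- with a_i ∈ {0,1}; hyperplane = {x : Σ a_i x_i = 0}. Distinct coefficient
-- vectors give distinct hyperplanes (a_d = -1 is fixed).
hyperplaneSet : (n : ℕ) → List (Vec ℤ (suc n))
hyperplaneSet n = map (_∷ʳ -[1+ 0 ]) (allVecs (+ 0 ∷ + 1 ∷ []) n)

_liesOn_ : ∀ {d} → Vec ℤ d → Vec ℤ d → Set
p liesOn a = dot a p ≡ + 0

incidences : ∀ {d} → List (Vec ℤ d) → List (Vec ℤ d) → ℕ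
incidences P H = length (filter (λ { (p , a) → dot a p ℤ.≟ + 0 }) (cartesianProduct P H))

-- For v ∈ {±1}ⁿ and a ∈ {0,1}ⁿ, the pair (v, a) accounts for exactly one incidence (with the point
-- (v, a·v)) when s = a·v lies in [-2m, 2m], and otherwise s² ≥ (2m+1)² =: K. Hence K ≤ K·[|s| ≤ 2m] + s²,
-- and summing over the 4ⁿ pairs gives K·4ⁿ ≤ K·I + Σ s². Because the coordinates of v are balanced,
-- the cross terms of Σ s² cancel and Σ s² = n·4ⁿ/2 ≤ K·4ⁿ/8 when n = m². So I ≥ 7·4ⁿ/8 ≥ 2^(2d)/8.
module Submission where

open import Defs
open import Data.Nat using (ℕ)
open import Data.Integer using (ℤ)
open import Data.List using (List)

module ListSum where
  open import Data.Integer using (0ℤ; 1ℤ; +_; _+_; _*_; _≤_)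
  open import Data.Integer.Properties
    using (≤-refl; +-mono-≤; +-identityˡ; +-assoc; *-zeroʳ; *-distribˡ-+; i≤i+j; i≤j⇒i≤k+j)
  open import Data.Integer.Tactic.RingSolver using (solve-∀)
  import Data.Integer as ℤ
  open import Data.Nat using (z≤n)
  open import Data.List using ([]; _∷_; _++_; map; concatMap; length; filter; cartesianProduct)
  open import Data.List.Membership.Propositional using (_∈_)
  open import Data.List.Relation.Unary.Any using (here; there)
  open import Data.Product using (_×_; _,_)
  open import Relation.Nullary using (Dec; yes; no; contradiction)
  open import Relation.Unary using (Pred; Decidable)
  open import Relation.Binary.PropositionalEquality using (_≡_; refl; sym; trans; cong; cong₂)

  private variable
    A B : Set

  ∑ : List A → (A → ℤ) → ℤ
  ∑ []       f = 0ℤ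
  ∑ (x ∷ xs) f = f x + ∑ xs f

  infix 5 ∑
  syntax ∑ xs (λ x → e) = ∑[ x ∈ xs ] e

  𝟙 : ∀ {p} {P : Set p} → Dec P → ℤ
  𝟙 (yes _) = 1ℤ
  𝟙 (no _)  = 0ℤ

  𝟙-yes : ∀ {p} {P : Set p} (P? : Dec P) → P → 𝟙 P? ≡ 1ℤ
  𝟙-yes (yes _) _ = refl
  𝟙-yes (no ¬p) p = contradiction p ¬p

  𝟙≥0 : ∀ {p} {P : Set p} (P? : Dec P) → 0ℤ ≤ 𝟙 P?
  𝟙≥0 (yes _) = ℤ.+≤+ z≤n
  𝟙≥0 (no _)  = ℤ.+≤+ z≤n

  length-filter : ∀ {ℓ} {P : Pred A ℓ} (P? : Decidable P) (xs : List A) →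
                  + length (filter P? xs) ≡ ∑[ x ∈ xs ] 𝟙 (P? x)
  length-filter P? []       = refl
  length-filter P? (x ∷ xs) with P? x
  ... | yes _ = cong (_+_ 1ℤ) (length-filter P? xs)
  ... | no _  = trans (length-filter P? xs) (sym (+-identityˡ _))

  ∑-cong : (xs : List A) {f g : A → ℤ} → (∀ x → f x ≡ g x) → ∑ xs f ≡ ∑ xs g
  ∑-cong []       f≡g = refl
  ∑-cong (x ∷ xs) f≡g = cong₂ _+_ (f≡g x) (∑-cong xs f≡g)

  ∑-mono : (xs : List A) {f g : A → ℤ} → (∀ x → f x ≤ g x) → ∑ xs f ≤ ∑ xs g
  ∑-mono []       f≤g = ≤-refl
  ∑-mono (x ∷ xs) f≤g = +-mono-≤ (f≤g x) (∑-mono xs f≤g)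

  ∑-nonNeg : (xs : List A) {f : A → ℤ} → (∀ x → 0ℤ ≤ f x) → 0ℤ ≤ ∑ xs f
  ∑-nonNeg []       f≥0 = ≤-refl
  ∑-nonNeg (x ∷ xs) f≥0 = +-mono-≤ (f≥0 x) (∑-nonNeg xs f≥0)

  ∈⇒≤∑ : (xs : List A) {f : A → ℤ} {x : A} → (∀ y → 0ℤ ≤ f y) → x ∈ xs → f x ≤ ∑ xs f
  ∈⇒≤∑ (y ∷ xs)     f≥0 (here refl) = i≤i+j _ _ {{ℤ.nonNegative (∑-nonNeg xs f≥0)}}
  ∈⇒≤∑ (y ∷ xs) {f} f≥0 (there x∈xs) = i≤j⇒i≤k+j (f y) {{ℤ.nonNegative (f≥0 y)}} (∈⇒≤∑ xs f≥0 x∈xs)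

  ∑-++ : (xs ys : List A) (f : A → ℤ) → ∑ (xs ++ ys) f ≡ ∑ xs f + ∑ ys f
  ∑-++ []       ys f = sym (+-identityˡ _)
  ∑-++ (x ∷ xs) ys f = trans (cong (_+_ (f x)) (∑-++ xs ys f)) (sym (+-assoc (f x) _ _))

  ∑-map : (xs : List A) (g : A → B) (f : B → ℤ) → ∑ (map g xs) f ≡ ∑[ x ∈ xs ] f (g x)
  ∑-map []       g f = refl
  ∑-map (x ∷ xs) g f = cong (_+_ (f (g x))) (∑-map xs g f)

  ∑-concatMap : (xs : List A) (g : A → List B) (f : B → ℤ) →
                ∑ (concatMap g xs) f ≡ ∑[ x ∈ xs ] ∑ (g x) f
  ∑-concatMap []       g f = refl
  ∑-concatMap (x ∷ xs) g f = trans (∑-++ (g x) _ f) (cong (_+_ (∑ (g x) f)) (∑-concatMap xs g f))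

  ∑-cartesianProduct : (xs : List A) (ys : List B) (f : A × B → ℤ) →
                       ∑ (cartesianProduct xs ys) f ≡ ∑[ x ∈ xs ] ∑[ y ∈ ys ] f (x , y)
  ∑-cartesianProduct []       ys f = refl
  ∑-cartesianProduct (x ∷ xs) ys f =
    trans (∑-++ (map (x ,_) ys) _ f) (cong₂ _+_ (∑-map ys (x ,_) f) (∑-cartesianProduct xs ys f))

  ∑-*ˡ : (xs : List A) (k : ℤ) (f : A → ℤ) → ∑[ x ∈ xs ] (k * f x) ≡ k * ∑ xs f
  ∑-*ˡ []       k f = sym (*-zeroʳ k)
  ∑-*ˡ (x ∷ xs) k f = trans (cong (_+_ (k * f x)) (∑-*ˡ xs k f)) (sym (*-distribˡ-+ k (f x) _))

  ∑-const : (xs : List A) (k : ℤ) → ∑[ x ∈ xs ] k ≡ + length xs * k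
  ∑-const []       k = refl
  ∑-const (x ∷ xs) k = trans (cong (_+_ k) (∑-const xs k)) (step k (+ length xs))
    where step : ∀ k n → k + n * k ≡ (1ℤ + n) * k
          step = solve-∀

  ∑-linear : (xs : List A) (f g : A → ℤ) (α β γ : ℤ) →
             ∑[ x ∈ xs ] (f x * α + g x * β + γ) ≡ ∑ xs f * α + ∑ xs g * β + + length xs * γ
  ∑-linear []       f g α β γ = refl
  ∑-linear (x ∷ xs) f g α β γ =
    trans (cong (_+_ (f x * α + g x * β + γ)) (∑-linear xs f g α β γ))
          (regroup (f x) (g x) (∑ xs f) (∑ xs g) (+ length xs) α β γ)
    where regroup : ∀ a b F G n α β γ →
                    a * α + b * β + γ + (F * α + G * β + n * γ)
                      ≡ (a + F) * α + (b + G) * β + (1ℤ + n) * γ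
          regroup = solve-∀

  ∑-+ : (xs : List A) (f g : A → ℤ) → ∑[ x ∈ xs ] (f x + g x) ≡ ∑ xs f + ∑ xs g
  ∑-+ []       f g = refl
  ∑-+ (x ∷ xs) f g = trans (cong (_+_ (f x + g x)) (∑-+ xs f g)) (swap (f x) (g x) (∑ xs f) (∑ xs g))
    where swap : ∀ a b c d → a + b + (c + d) ≡ a + c + (b + d)
          swap = solve-∀

  ∑-comm : (xs : List A) (ys : List B) (f : A → B → ℤ) →
           ∑[ x ∈ xs ] ∑[ y ∈ ys ] f x y ≡ ∑[ y ∈ ys ] ∑[ x ∈ xs ] f x y
  ∑-comm []       ys f = sym (trans (∑-const ys 0ℤ) (*-zeroʳ (+ length ys)))
  ∑-comm (x ∷ xs) ys f =
    trans (cong (_+_ (∑ ys (f x))) (∑-comm xs ys f)) (sym (∑-+ ys (f x) (λ y → ∑[ x′ ∈ xs ] f x′ y)))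

module AllVecs where
  open ListSum
  open import Data.Nat as ℕ using (zero; suc; _^_)
  open import Data.List using ([]; _∷_; map; concatMap; length)
  open import Data.List.Properties using (length-++; length-map)
  open import Data.Vec using (Vec; _∷_)
  open import Relation.Binary.PropositionalEquality using (_≡_; refl; trans; cong; cong₂)

  ∑-allVecs : (X : List ℤ) (n : ℕ) (f : Vec ℤ (suc n) → ℤ) →
              ∑ (allVecs X (suc n)) f ≡ ∑[ x ∈ X ] ∑[ v ∈ allVecs X n ] f (x ∷ v)
  ∑-allVecs X n f = trans (∑-concatMap X _ f) (∑-cong X (λ x → ∑-map (allVecs X n) (x ∷_) f))

  length-allVecs-suc : (X : List ℤ) (n : ℕ) → length (allVecs X (suc n)) ≡ length X ℕ.* length (allVecs X n)
  length-allVecs-suc X n = length-prefixed X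
    where
    V = allVecs X n
    length-prefixed : ∀ xs → length (concatMap (λ x → map (x ∷_) V) xs) ≡ length xs ℕ.* length V
    length-prefixed []       = refl
    length-prefixed (x ∷ xs) =
      trans (length-++ (map (x ∷_) V)) (cong₂ ℕ._+_ (length-map (x ∷_) V) (length-prefixed xs))

  length-allVecs : (X : List ℤ) (n : ℕ) → length (allVecs X n) ≡ length X ^ n
  length-allVecs X zero    = refl
  length-allVecs X (suc n) = trans (length-allVecs-suc X n) (cong (length X ℕ.*_) (length-allVecs X n))

module SecondMoment (X C : List ℤ) where
  open ListSum
  open AllVecs
  open import Data.Nat using (zero; suc)
  open import Data.Integer using (0ℤ; 1ℤ; +_; _+_; _*_)
  open import Data.Integer.Properties using (pos-*; *-zeroʳ)
  open import Data.Integer.Tactic.RingSolver using (solve-∀)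
  open import Data.List using (length)
  open import Data.Vec using (Vec; _∷_)
  open import Relation.Binary.PropositionalEquality
  open ≡-Reasoning

  ∑dot ∑dot² : (n : ℕ) → Vec ℤ n → ℤ
  ∑dot  n v = ∑[ a ∈ allVecs C n ] dot a v
  ∑dot² n v = ∑[ a ∈ allVecs C n ] dot a v * dot a v

  secondMoment : ℕ → ℤ
  secondMoment n = ∑[ v ∈ allVecs X n ] ∑dot² n v

  ∑X² ∑X ∑C² ∑C : ℤ
  ∑X² = ∑[ x ∈ X ] x * x
  ∑X  = ∑[ x ∈ X ] x
  ∑C² = ∑[ c ∈ C ] c * c
  ∑C  = ∑[ c ∈ C ] c

  #X #C : ℕ → ℤ
  #X n = + length (allVecs X n)
  #C n = + length (allVecs C n)

  ∑dot²-∷ : ∀ n x v → ∑dot² (suc n) (x ∷ v) ≡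
            ∑C² * (x * x * #C n) + ∑C * (+ 2 * x * ∑dot n v) + + length C * ∑dot² n v
  ∑dot²-∷ n x v = begin
      ∑dot² (suc n) (x ∷ v)
    ≡⟨ ∑-allVecs C n _ ⟩
      ∑[ c ∈ C ] ∑[ a ∈ allVecs C n ] (c * x + dot a v) * (c * x + dot a v)
    ≡⟨ ∑-cong C ∑-shifted-square ⟩
      ∑[ c ∈ C ] (c * c * (x * x * #C n) + c * (+ 2 * x * ∑dot n v) + ∑dot² n v)
    ≡⟨ ∑-linear C (λ c → c * c) (λ c → c) _ _ _ ⟩
      ∑C² * (x * x * #C n) + ∑C * (+ 2 * x * ∑dot n v) + + length C * ∑dot² n v
    ∎
    where
    A = allVecs C n
    ∑-shifted-square : ∀ c → ∑[ a ∈ A ] (c * x + dot a v) * (c * x + dot a v)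
                             ≡ c * c * (x * x * #C n) + c * (+ 2 * x * ∑dot n v) + ∑dot² n v
    ∑-shifted-square c = begin
        ∑[ a ∈ A ] (c * x + dot a v) * (c * x + dot a v)
      ≡⟨ ∑-cong A (λ a → expand (c * x) (dot a v)) ⟩
        ∑[ a ∈ A ] (dot a v * (+ 2 * (c * x)) + dot a v * dot a v * 1ℤ + c * x * (c * x))
      ≡⟨ ∑-linear A (λ a → dot a v) (λ a → dot a v * dot a v) _ _ _ ⟩
        ∑dot n v * (+ 2 * (c * x)) + ∑dot² n v * 1ℤ + #C n * (c * x * (c * x))
      ≡⟨ regroup c x (∑dot n v) (∑dot² n v) (#C n) ⟩
        c * c * (x * x * #C n) + c * (+ 2 * x * ∑dot n v) + ∑dot² n v
      ∎
      where
      expand : ∀ k s → (k + s) * (k + s) ≡ s * (+ 2 * k) + s * s * 1ℤ + k * k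
      expand = solve-∀
      regroup : ∀ c x d₁ d₂ N → d₁ * (+ 2 * (c * x)) + d₂ * 1ℤ + N * (c * x * (c * x))
                                ≡ c * c * (x * x * N) + c * (+ 2 * x * d₁) + d₂
      regroup = solve-∀

  #-suc : ∀ Y n → + length (allVecs Y (suc n)) ≡ + length Y * + length (allVecs Y n)
  #-suc Y n = trans (cong +_ (length-allVecs-suc Y n)) (pos-* (length Y) _)

  module _ (balanced : ∑X ≡ 0ℤ) where

    secondMoment-suc : ∀ n → secondMoment (suc n) ≡
                       ∑X² * ∑C² * (#X n * #C n) + + length X * + length C * secondMoment n
    secondMoment-suc n = begin
        secondMoment (suc n)
      ≡⟨ ∑-allVecs X n _ ⟩
        ∑[ x ∈ X ] ∑[ v ∈ V ] ∑dot² (suc n) (x ∷ v)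
      ≡⟨ ∑-cong X (λ x → ∑-cong V (λ v → trans (∑dot²-∷ n x v)
           (split-by-v x ∑C² ∑C (#C n) (+ length C) (∑dot n v) (∑dot² n v)))) ⟩
        ∑[ x ∈ X ] ∑[ v ∈ V ] (∑dot n v * (∑C * (+ 2 * x)) + ∑dot² n v * + length C + ∑C² * (x * x * #C n))
      ≡⟨ ∑-cong X (λ x → ∑-linear V (∑dot n) (∑dot² n) _ _ _) ⟩
        ∑[ x ∈ X ] (M₁ * (∑C * (+ 2 * x)) + secondMoment n * + length C + #X n * (∑C² * (x * x * #C n)))
      ≡⟨ ∑-cong X (λ x → split-by-x x M₁ (secondMoment n) (#X n) ∑C² (#C n) ∑C (+ length C)) ⟩
        ∑[ x ∈ X ] (x * x * (∑C² * #X n * #C n) + x * (+ 2 * ∑C * M₁) + + length C * secondMoment n)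
      ≡⟨ ∑-linear X (λ x → x * x) (λ x → x) _ _ _ ⟩
        ∑X² * (∑C² * #X n * #C n) + ∑X * (+ 2 * ∑C * M₁) + + length X * (+ length C * secondMoment n)
      ≡⟨ cong (λ s → ∑X² * (∑C² * #X n * #C n) + s * (+ 2 * ∑C * M₁) + + length X * (+ length C * secondMoment n))
              balanced ⟩
        ∑X² * (∑C² * #X n * #C n) + 0ℤ * (+ 2 * ∑C * M₁) + + length X * (+ length C * secondMoment n)
      ≡⟨ collect ∑X² ∑C² (#X n) (#C n) (+ 2 * ∑C * M₁) (+ length X) (+ length C) (secondMoment n) ⟩
        ∑X² * ∑C² * (#X n * #C n) + + length X * + length C * secondMoment n
      ∎
      where
      V = allVecs X n
      M₁ = ∑[ v ∈ V ] ∑dot n v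
      split-by-v : ∀ x C₂ C₁ N L d₁ d₂ → C₂ * (x * x * N) + C₁ * (+ 2 * x * d₁) + L * d₂
                                           ≡ d₁ * (C₁ * (+ 2 * x)) + d₂ * L + C₂ * (x * x * N)
      split-by-v = solve-∀
      split-by-x : ∀ x M₁ M₂ NX C₂ NC C₁ L → M₁ * (C₁ * (+ 2 * x)) + M₂ * L + NX * (C₂ * (x * x * NC))
                                              ≡ x * x * (C₂ * NX * NC) + x * (+ 2 * C₁ * M₁) + L * M₂
      split-by-x = solve-∀
      collect : ∀ X₂ C₂ NX NC K LX LC M → X₂ * (C₂ * NX * NC) + 0ℤ * K + LX * (LC * M)
                                          ≡ X₂ * C₂ * (NX * NC) + LX * LC * M
      collect = solve-∀

    secondMoment-formula : ∀ n → + length X * + length C * secondMoment n ≡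
                                 + n * (∑X² * ∑C²) * (#X n * #C n)
    secondMoment-formula zero    = *-zeroʳ (+ length X * + length C)
    secondMoment-formula (suc n) = begin
        LX * LC * secondMoment (suc n)
      ≡⟨ cong (_*_ (LX * LC)) (secondMoment-suc n) ⟩
        LX * LC * (∑X² * ∑C² * (#X n * #C n) + LX * LC * secondMoment n)
      ≡⟨ cong (λ t → LX * LC * (∑X² * ∑C² * (#X n * #C n) + t)) (secondMoment-formula n) ⟩
        LX * LC * (∑X² * ∑C² * (#X n * #C n) + + n * (∑X² * ∑C²) * (#X n * #C n))
      ≡⟨ factor LX LC ∑X² ∑C² (#X n) (#C n) (+ n) ⟩
        (1ℤ + + n) * (∑X² * ∑C²) * (LX * #X n * (LC * #C n))
      ≡⟨ sym (cong₂ (λ a b → (1ℤ + + n) * (∑X² * ∑C²) * (a * b)) (#-suc X n) (#-suc C n)) ⟩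
        + suc n * (∑X² * ∑C²) * (#X (suc n) * #C (suc n))
      ∎
      where
      LX = + length X
      LC = + length C
      factor : ∀ LX LC X₂ C₂ NX NC n → LX * LC * (X₂ * C₂ * (NX * NC) + n * (X₂ * C₂) * (NX * NC))
                                        ≡ (1ℤ + n) * (X₂ * C₂) * (LX * NX * (LC * NC))
      factor = solve-∀

module SquareOrHit where
  open import Data.Nat as ℕ using (suc; _≤_; _≤?_)
  open import Data.Nat.Properties using (≤-trans; m≤m*n; m≤m+n; m≤n+m; *-mono-≤; ≰⇒>)
  open import Data.Integer as ℤ using (+_; -[1+_]; 0ℤ; 1ℤ; _+_; _*_; ∣_∣)
  open import Data.Integer.Properties using (pos-+; pos-*; drop‿+≤+)
  open import Relation.Nullary using (yes; no)
  open import Relation.Binary.PropositionalEquality using (_≡_; refl; sym; trans; cong₂; subst)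

  square-or-hitℕ : ∀ B a ρ → (a ≤ B → 1 ≤ ρ) → suc B ℕ.* suc B ≤ suc B ℕ.* suc B ℕ.* ρ ℕ.+ a ℕ.* a
  square-or-hitℕ B a ρ hit with a ≤? B
  ... | yes a≤B = ≤-trans (m≤m*n _ ρ {{ℕ.>-nonZero (hit a≤B)}}) (m≤m+n _ (a ℕ.* a))
  ... | no  a≰B = ≤-trans (*-mono-≤ (≰⇒> a≰B) (≰⇒> a≰B)) (m≤n+m (a ℕ.* a) _)

  square≡∣∣² : ∀ s → s * s ≡ + (∣ s ∣ ℕ.* ∣ s ∣)
  square≡∣∣² (+ j)    = sym (pos-* j j)
  square≡∣∣² -[1+ j ] = refl

  square-or-hit : ∀ B s r → 0ℤ ℤ.≤ r → (∣ s ∣ ≤ B → 1ℤ ℤ.≤ r) →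
                  + (suc B ℕ.* suc B) ℤ.≤ + (suc B ℕ.* suc B) * r + s * s
  square-or-hit B s (+ ρ) _ hit =
    subst (+ (suc B ℕ.* suc B) ℤ.≤_) (sym eq)
          (ℤ.+≤+ (square-or-hitℕ B ∣ s ∣ ρ (λ s≤B → drop‿+≤+ (hit s≤B))))
    where
    eq : + (suc B ℕ.* suc B) * + ρ + s * s ≡ + (suc B ℕ.* suc B ℕ.* ρ ℕ.+ ∣ s ∣ ℕ.* ∣ s ∣)
    eq = trans (cong₂ _+_ (sym (pos-* (suc B ℕ.* suc B) ρ)) (square≡∣∣² s)) (sym (pos-+ (suc B ℕ.* suc B ℕ.* ρ) _))

module Hits where
  open ListSum
  open import Data.Nat as ℕ using (suc; s≤s; _≤_)
  open import Data.Nat.Properties as ℕ using (≤-trans; ≤-reflexive; +-monoˡ-≤; m∸n≤m; m≤m*n; m+[n∸m]≡n)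
  import Data.Nat.Tactic.RingSolver as ℕ-Solver
  open import Data.Integer as ℤ using (+_; -[1+_]; 0ℤ; 1ℤ; -1ℤ; _+_; _-_; _*_; -_; ∣_∣; _≟_)
  open import Data.Integer.Properties as ℤ using (pos-+; -1*i≡-i; +-inverseʳ)
  open import Data.Integer.Tactic.RingSolver using (solve-∀)
  open import Data.List.Membership.Propositional using (_∈_)
  open import Data.List.Membership.Propositional.Properties using (∈-map⁺; ∈-upTo⁺)
  open import Relation.Binary.PropositionalEquality using (_≡_; sym; trans; cong; subst)

  ∈-intRange : ∀ {B} s → ∣ s ∣ ≤ B → s ∈ intRange B
  ∈-intRange {B} (+ j) j≤B =
    subst (_∈ intRange B) (trans (cong (_- + B) (pos-+ j B)) (cancel (+ j) (+ B)))
          (∈-map⁺ (λ k → + k - + B) (∈-upTo⁺ (s≤s (≤-trans (+-monoˡ-≤ B j≤B) (≤-reflexive (double B))))))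
    where
    cancel : ∀ i b → i + b - b ≡ i
    cancel = solve-∀
    double : ∀ b → b ℕ.+ b ≡ b ℕ.* 2
    double = ℕ-Solver.solve-∀
  ∈-intRange {B} -[1+ j ] 1+j≤B =
    subst (_∈ intRange B) (trans (cong (λ b → + r - b) (sym B≡1+j+r)) (cancel (+ suc j) (+ r)))
          (∈-map⁺ (λ k → + k - + B) (∈-upTo⁺ (s≤s (≤-trans (m∸n≤m B (suc j)) (m≤m*n B 2)))))
    where
    r = B ℕ.∸ suc j
    B≡1+j+r : + suc j + + r ≡ + B
    B≡1+j+r = trans (sym (pos-+ (suc j) r)) (cong +_ (m+[n∸m]≡n 1+j≤B))
    cancel : ∀ i r → r - (i + r) ≡ - i
    cancel = solve-∀

  -- s + (-1)·t is the dot product of (a, -1) with the point (v, t) when s = a·v.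
  hits : ℕ → ℤ → ℤ
  hits B s = ∑[ t ∈ intRange B ] 𝟙 (s + -1ℤ * t ≟ 0ℤ)

  hits≥0 : ∀ B s → 0ℤ ℤ.≤ hits B s
  hits≥0 B s = ∑-nonNeg (intRange B) (λ t → 𝟙≥0 (s + -1ℤ * t ≟ 0ℤ))

  hits≥1 : ∀ B s → ∣ s ∣ ≤ B → 1ℤ ℤ.≤ hits B s
  hits≥1 B s s≤B =
    subst (ℤ._≤ hits B s) (𝟙-yes (s + -1ℤ * s ≟ 0ℤ) (trans (cong (_+_ s) (-1*i≡-i s)) (+-inverseʳ s)))
          (∈⇒≤∑ (intRange B) (λ t → 𝟙≥0 (s + -1ℤ * t ≟ 0ℤ)) (∈-intRange s s≤B))

module Averaging where
  open import Data.Nat using (s≤s; z≤n)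
  open import Data.Integer as ℤ using (+_; 0ℤ; _+_; _-_; _*_; -_; _≤_; Positive; nonNegative)
  open import Data.Integer.Properties
    using (≤-trans; +-monoˡ-≤; +-monoʳ-≤; *-monoˡ-≤-nonNeg; *-monoʳ-≤-nonNeg; *-cancelˡ-≤-pos; module ≤-Reasoning)
  open import Data.Integer.Tactic.RingSolver using (solve)
  open import Data.List using ([]; _∷_)
  open import Relation.Binary.PropositionalEquality using (_≡_; cong)

  averaging : ∀ (K I M N Q : ℤ) .{{_ : Positive K}} → 0ℤ ≤ Q →
              K * Q ≤ K * I + M → + 4 * M ≡ N * + 2 * Q → + 4 * N ≤ K → + 4 * Q ≤ + 8 * I
  averaging K I M N Q Q≥0 KQ≤KI+M 4M≡2NQ 4N≤K =
    ≤-trans (*-monoʳ-≤-nonNeg Q {{nonNegative Q≥0}} {+ 4} {+ 7} (ℤ.+≤+ (s≤s (s≤s (s≤s (s≤s z≤n))))))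
            (*-cancelˡ-≤-pos (+ 7 * Q) (+ 8 * I) K K7Q≤K8I)
    where
    open ≤-Reasoning
    K7Q≤K8I : K * (+ 7 * Q) ≤ K * (+ 8 * I)
    K7Q≤K8I = begin
      K * (+ 7 * Q)                                 ≡⟨ solve (K ∷ Q ∷ []) ⟩
      + 8 * (K * Q) - K * Q                         ≤⟨ +-monoˡ-≤ (- (K * Q)) (*-monoˡ-≤-nonNeg (+ 8) KQ≤KI+M) ⟩
      + 8 * (K * I + M) - K * Q                     ≡⟨ solve (K ∷ Q ∷ I ∷ M ∷ []) ⟩
      K * (+ 8 * I) + (+ 2 * (+ 4 * M) - K * Q)     ≡⟨ cong (λ t → K * (+ 8 * I) + (+ 2 * t - K * Q)) 4M≡2NQ ⟩
      K * (+ 8 * I) + (+ 2 * (N * + 2 * Q) - K * Q) ≡⟨ solve (K ∷ Q ∷ I ∷ N ∷ []) ⟩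
      K * (+ 8 * I) + (+ 4 * N * Q - K * Q)         ≤⟨ +-monoʳ-≤ (K * (+ 8 * I)) (+-monoˡ-≤ (- (K * Q))
                                                         (*-monoʳ-≤-nonNeg Q {{nonNegative Q≥0}} 4N≤K)) ⟩
      K * (+ 8 * I) + (K * Q - K * Q)               ≡⟨ solve (K ∷ Q ∷ I ∷ []) ⟩
      K * (+ 8 * I)                                 ∎

module Incidence where
  open ListSum
  open import Data.Integer using (0ℤ; +_; _+_; _*_; _≟_)
  open import Data.Integer.Properties using (+-comm; +-assoc)
  open import Data.List using (cartesianProduct)
  open import Data.Vec using (Vec; []; _∷_; _∷ʳ_)
  open import Relation.Binary.PropositionalEquality using (_≡_; sym; trans; cong)

  dot-∷ʳ : ∀ {k} (a v : Vec ℤ k) x y → dot (a ∷ʳ x) (v ∷ʳ y) ≡ dot a v + x * y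
  dot-∷ʳ []       []       x y = +-comm (x * y) 0ℤ
  dot-∷ʳ (a ∷ as) (v ∷ vs) x y = trans (cong (_+_ (a * v)) (dot-∷ʳ as vs x y)) (sym (+-assoc (a * v) _ _))

  incidences≡∑ : ∀ {d} (P H : List (Vec ℤ d)) →
                 + incidences P H ≡ ∑[ p ∈ P ] ∑[ h ∈ H ] 𝟙 (dot h p ≟ 0ℤ)
  incidences≡∑ P H = trans (length-filter _ (cartesianProduct P H)) (∑-cartesianProduct P H _)

module Bound (n m : ℕ) where
  open ListSum
  open AllVecs
  open Incidence
  open Hits
  open SquareOrHit
  open Averaging
  open import Data.Nat as ℕ using (suc)
  import Data.Nat.Properties as ℕ
  import Data.Nat.Tactic.RingSolver as ℕ-Solver
  open import Data.Integer as ℤ using (+_; 0ℤ; 1ℤ; -1ℤ; _+_; _*_; _≤_; _≟_)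
  open import Data.Integer.Properties using (pos-*)
  open import Data.List using ([]; _∷_; map; length)
  open import Data.Vec using (Vec; _∷ʳ_)
  open import Data.Integer.Tactic.RingSolver using (solve-∀)
  open import Relation.Binary.PropositionalEquality
  open ≡-Reasoning

  signs bits : List ℤ
  signs = -1ℤ ∷ 1ℤ ∷ []
  bits  = 0ℤ ∷ 1ℤ ∷ []

  open SecondMoment signs bits

  B = 2 ℕ.* m
  R = intRange B
  V = allVecs signs n
  A = allVecs bits n
  K = + (suc B ℕ.* suc B)

  I : ℤ
  I = ∑[ v ∈ V ] ∑[ a ∈ A ] hits B (dot a v)

  incidences≡I : + incidences (pointSet n m) (hyperplaneSet n) ≡ I
  incidences≡I = begin
      + incidences (pointSet n m) (hyperplaneSet n)
    ≡⟨ incidences≡∑ (pointSet n m) (hyperplaneSet n) ⟩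
      ∑[ p ∈ pointSet n m ] ∑[ h ∈ hyperplaneSet n ] 𝟙 (dot h p ≟ 0ℤ)
    ≡⟨ ∑-concatMap V (λ v → map (v ∷ʳ_) R) onSomeHyperplane ⟩
      ∑[ v ∈ V ] ∑[ p ∈ map (v ∷ʳ_) R ] onSomeHyperplane p
    ≡⟨ ∑-cong V (λ v → ∑-map R (v ∷ʳ_) onSomeHyperplane) ⟩
      ∑[ v ∈ V ] ∑[ t ∈ R ] ∑[ h ∈ hyperplaneSet n ] 𝟙 (dot h (v ∷ʳ t) ≟ 0ℤ)
    ≡⟨ ∑-cong V (λ v → ∑-cong R (λ t → trans (∑-map A (_∷ʳ -1ℤ) _) (∑-cong A (λ a →
         cong (λ z → 𝟙 (z ≟ 0ℤ)) (dot-∷ʳ a v -1ℤ t))))) ⟩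
      ∑[ v ∈ V ] ∑[ t ∈ R ] ∑[ a ∈ A ] 𝟙 (dot a v + -1ℤ * t ≟ 0ℤ)
    ≡⟨ ∑-cong V (λ v → ∑-comm R A (λ t a → 𝟙 (dot a v + -1ℤ * t ≟ 0ℤ))) ⟩
      I
    ∎
    where
    onSomeHyperplane : Vec ℤ (suc n) → ℤ
    onSomeHyperplane p = ∑[ h ∈ hyperplaneSet n ] 𝟙 (dot h p ≟ 0ℤ)

  K*count≤K*I+secondMoment : K * (#X n * #C n) ≤ K * I + secondMoment n
  K*count≤K*I+secondMoment = subst₂ _≤_ lhs rhs
    (∑-mono V (λ v → ∑-mono A (λ a →
      square-or-hit B (dot a v) (hits B (dot a v)) (hits≥0 B (dot a v)) (hits≥1 B (dot a v)))))
    where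
    lhs : ∑[ v ∈ V ] ∑[ a ∈ A ] K ≡ K * (#X n * #C n)
    lhs = trans (∑-cong V (λ v → ∑-const A K)) (trans (∑-const V _) (rearrange (#X n) (#C n) K))
      where rearrange : ∀ a b k → a * (b * k) ≡ k * (a * b)
            rearrange = solve-∀
    rhs : ∑[ v ∈ V ] ∑[ a ∈ A ] (K * hits B (dot a v) + dot a v * dot a v) ≡ K * I + secondMoment n
    rhs = trans (∑-cong V (λ v → trans (∑-+ A _ _) (cong (_+ ∑dot² n v) (∑-*ˡ A K _))))
                (trans (∑-+ V _ _) (cong (_+ secondMoment n) (∑-*ˡ V K _)))

  2^2d≡4*count : + (2 ℕ.^ (2 ℕ.* suc n)) ≡ + 4 * (#X n * #C n)
  2^2d≡4*count = begin
      + (2 ℕ.^ (2 ℕ.* suc n))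
    ≡⟨ cong +_ (2^[2+2n] n) ⟩
      + (4 ℕ.* (2 ℕ.^ n ℕ.* 2 ℕ.^ n))
    ≡⟨ trans (pos-* 4 (2 ℕ.^ n ℕ.* 2 ℕ.^ n)) (cong (_*_ (+ 4)) (pos-* (2 ℕ.^ n) (2 ℕ.^ n))) ⟩
      + 4 * (+ (2 ℕ.^ n) * + (2 ℕ.^ n))
    ≡⟨ sym (cong₂ (λ a b → + 4 * (+ a * + b)) (length-allVecs signs n) (length-allVecs bits n)) ⟩
      + 4 * (#X n * #C n)
    ∎
    where
    2^[2+2n] : ∀ n → 2 ℕ.^ (2 ℕ.* suc n) ≡ 4 ℕ.* (2 ℕ.^ n ℕ.* 2 ℕ.^ n)
    2^[2+2n] n = trans (cong (2 ℕ.^_) (cong (suc n ℕ.+_) (ℕ.+-identityʳ (suc n))))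
                       (trans (ℕ.^-distribˡ-+-* 2 (suc n) (suc n)) (square-double (2 ℕ.^ n)))
      where square-double : ∀ p → 2 ℕ.* p ℕ.* (2 ℕ.* p) ≡ 4 ℕ.* (p ℕ.* p)
            square-double = ℕ-Solver.solve-∀

  4n≤K : n ≡ m ℕ.* m → + 4 * + n ≤ K
  4n≤K n≡m² = subst (_≤ K) (pos-* 4 n) (ℤ.+≤+ (subst (λ k → 4 ℕ.* k ℕ.≤ suc B ℕ.* suc B) (sym n≡m²) 4m²≤[1+2m]²))
    where
    4m²≡[2m]² : ∀ m → 4 ℕ.* (m ℕ.* m) ≡ 2 ℕ.* m ℕ.* (2 ℕ.* m)
    4m²≡[2m]² = ℕ-Solver.solve-∀
    4m²≤[1+2m]² : 4 ℕ.* (m ℕ.* m) ℕ.≤ suc B ℕ.* suc B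
    4m²≤[1+2m]² = ℕ.≤-trans (ℕ.≤-reflexive (4m²≡[2m]² m)) (ℕ.*-mono-≤ (ℕ.n≤1+n B) (ℕ.n≤1+n B))

  incidence-bound : n ≡ m ℕ.* m → + (2 ℕ.^ (2 ℕ.* suc n)) ≤ + 8 * + incidences (pointSet n m) (hyperplaneSet n)
  incidence-bound n≡m² =
    subst₂ _≤_ (sym 2^2d≡4*count) (cong (_*_ (+ 8)) (sym incidences≡I))
      (averaging K I (secondMoment n) (+ n) (#X n * #C n) count≥0
                 K*count≤K*I+secondMoment (secondMoment-formula refl n) (4n≤K n≡m²))
    where
    count≥0 : 0ℤ ≤ #X n * #C n
    count≥0 = subst (0ℤ ≤_) (pos-* (length V) (length A)) (ℤ.+≤+ ℕ.z≤n)

module RationalScaling where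
  open import Data.Integer as ℤ using (+_)
  open import Data.Integer.Properties as ℤ using ()
  open import Data.Nat.Coprimality using (1-coprimeTo; sym)
  open import Data.Rational using (mkℚ; _/_; _≤_; _*_)
  open import Data.Rational.Properties using (↥p/↧p≡p; toℚᵘ-cancel-≤; toℚᵘ-homo-*)
  import Data.Rational.Unnormalised as ℚᵘ
  import Data.Rational.Unnormalised.Properties as ℚᵘ
  open import Relation.Binary.PropositionalEquality using (_≡_; trans; subst₂)
    renaming (sym to ≡-sym)

  i/1≡mkℚ : ∀ i → i / 1 ≡ mkℚ i 0 (sym (1-coprimeTo ℤ.∣ i ∣))
  i/1≡mkℚ i = ↥p/↧p≡p (mkℚ i 0 (sym (1-coprimeTo ℤ.∣ i ∣)))

  x≤8y⇒x/8≤y : ∀ x y → x ℤ.≤ + 8 ℤ.* y → (+ 1 / 8) * (x / 1) ≤ y / 1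
  x≤8y⇒x/8≤y x y x≤8y rewrite i/1≡mkℚ x | i/1≡mkℚ y =
    toℚᵘ-cancel-≤ (ℚᵘ.≤-respˡ-≃ (ℚᵘ.≃-sym (toℚᵘ-homo-* (+ 1 / 8) (mkℚ x 0 (sym (1-coprimeTo ℤ.∣ x ∣)))))
                                 (ℚᵘ.*≤* (subst₂ ℤ._≤_ x≡1*x*1 (ℤ.*-comm (+ 8) y) x≤8y)))
    where
    x≡1*x*1 : x ≡ + 1 ℤ.* x ℤ.* + 1
    x≡1*x*1 = ≡-sym (trans (ℤ.*-identityʳ (+ 1 ℤ.* x)) (ℤ.*-identityˡ x))

open import Data.Nat using (ℕ; suc; _*_; _^_; _≤_; s≤s; z≤n)
open import Data.Integer using (+_; +<+)
open import Data.Rational using (ℚ; 0ℚ; _/_; *<*) renaming (_<_ to _<ℚ_; _≤_ to _≤ℚ_; _*_ to _*ℚ_)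
open import Data.Product using (Σ; _×_; _,_)
open import Relation.Binary.PropositionalEquality using (_≡_)
open RationalScaling using (x≤8y⇒x/8≤y)

-- The bound holds for n = 0 as well.
proposition4p4 : Σ ℚ (λ c → (0ℚ <ℚ c) × ((n m : ℕ) → 1 ≤ n → n ≡ m * m →
    c *ℚ ((+ (2 ^ (2 * suc n))) / 1) ≤ℚ ((+ incidences (pointSet n m) (hyperplaneSet n)) / 1)))
proposition4p4 = + 1 / 8 , *<* (+<+ (s≤s z≤n)) , λ n m _ n≡m² →
  x≤8y⇒x/8≤y (+ (2 ^ (2 * suc n))) (+ incidences (pointSet n m) (hyperplaneSet n))
             (Bound.incidence-bound n m n≡m²)
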